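{- Let $\mathbb{F}$ be a field of characteristic $0$, let $\mu_1,\ldots,\mu_d$ be distinct nonzero elements of $\mathbb{F}$, and let $y_1,\ldots,y_d$ be indeterminates. Let $A$ be the $d\times d$ matrix over the function field $\mathbb{F}(y_1,\ldots,y_d)$ with $(i,j)$-entry $1/(y_i-\mu_j)^2$. Then $\det(A)\neq 0$. -}

module Defs where

open import Level using (Level; _⊔_)
open import Data.Nat using (ℕ; zero; suc)
open import Data.Fin using (Fin; zero; suc; punchIn)
open import Data.List using (List; []; _∷_; map)
open import Data.List.Relation.Unary.All using (All)
open import Data.Product using (_×_; _,_; proj₁; proj₂; ∃)
open import Relation.Nullary using (¬_)
open import Relation.Binary.PropositionalEquality using (_≡_)
open import Algebra.Bundles using (CommutativeRing)

record Field (c ℓ : Level) : Set (Level.suc (c ⊔ ℓ)) where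
  field
    commutativeRing : CommutativeRing c ℓ
  open CommutativeRing commutativeRing public
  field
    1≉0     : ¬ (1# ≈ 0#)
    inverse : ∀ x → ¬ (x ≈ 0#) → ∃ λ y → (x * y) ≈ 1#

module _ {c ℓ} (F : Field c ℓ) where
  open Field F

  natF : ℕ → Carrier
  natF zero    = 0#
  natF (suc n) = 1# + natF n

  CharZero : Set ℓ
  CharZero = ∀ n → ¬ (natF (suc n) ≈ 0#)

-- Poly 0 = F;  Poly (suc n) = coefficient lists (constant term first) in
-- the variable number 0, with coefficients in Poly n (the other variables).
-- Representations are not normalised: equality is "difference has all
-- coefficients zero".

module Poly {c ℓ} (F : Field c ℓ) where
  open Field F

  Poly : ℕ → Set c
  Poly zero    = Carrier
  Poly (suc n) = List (Poly n)

  IsZero : ∀ n → Poly n → Set (c ⊔ ℓ)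
  IsZero zero    x = Level.Lift c (x ≈ 0#)
  IsZero (suc n) p = All (IsZero n) p

  zeroP : ∀ n → Poly n
  zeroP zero    = 0#
  zeroP (suc n) = []

  constP : ∀ n → Carrier → Poly n
  constP zero    a = a
  constP (suc n) a = constP n a ∷ []

  oneP : ∀ n → Poly n
  oneP n = constP n 1#

  negP : ∀ n → Poly n → Poly n
  negP zero    x = - x
  negP (suc n) p = map (negP n) p

  addL : ∀ {A : Set c} → (A → A → A) → List A → List A → List A
  addL f []       q        = q
  addL f (a ∷ p)  []       = a ∷ p
  addL f (a ∷ p)  (b ∷ q)  = f a b ∷ addL f p q

  addP : ∀ n → Poly n → Poly n → Poly n
  addP zero    x y = x + y
  addP (suc n) p q = addL (addP n) p q

  mulP : ∀ n → Poly n → Poly n → Poly n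
  mulL : ∀ n → List (Poly n) → List (Poly n) → List (Poly n)
  mulP zero    x y = x * y
  mulP (suc n) p q = mulL n p q
  mulL n []      q = []
  mulL n (a ∷ p) q = addL (addP n) (map (mulP n a) q) (zeroP n ∷ mulL n p q)

  subP : ∀ n → Poly n → Poly n → Poly n
  subP n p q = addP n p (negP n q)

  _≈P_ : ∀ {n} → Poly n → Poly n → Set (c ⊔ ℓ)
  _≈P_ {n} p q = IsZero n (subP n p q)

  var : ∀ n → Fin n → Poly n
  var (suc n) zero    = zeroP n ∷ oneP n ∷ []
  var (suc n) (suc i) = var n i ∷ []

  Frac : ℕ → Set c
  Frac n = Poly n × Poly n

  _≈F_ : ∀ {n} → Frac n → Frac n → Set (c ⊔ ℓ)
  _≈F_ {n} (a , b) (c′ , d) = _≈P_ {n} (mulP n a d) (mulP n c′ b)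

  0F 1F : ∀ {n} → Frac n
  0F {n} = zeroP n , oneP n
  1F {n} = oneP n , oneP n

  fromPoly : ∀ {n} → Poly n → Frac n
  fromPoly {n} p = p , oneP n

  _+F_ _*F_ _/F_ : ∀ {n} → Frac n → Frac n → Frac n
  _+F_ {n} (a , b) (c′ , d) = addP n (mulP n a d) (mulP n c′ b) , mulP n b d
  _*F_ {n} (a , b) (c′ , d) = mulP n a c′ , mulP n b d
  _/F_ {n} (a , b) (c′ , d) = mulP n a d , mulP n b c′

  -F_ : ∀ {n} → Frac n → Frac n
  -F_ {n} (a , b) = negP n a , b

module Det {a} {A : Set a} (_+_ _*_ : A → A → A) (-_ : A → A) (0# 1# : A) where

  altSum : ∀ m → (Fin m → A) → A
  altSum zero    f = 0#
  altSum (suc m) f = f zero + (- altSum m (λ j → f (suc j)))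

  det : ∀ m → (Fin m → Fin m → A) → A
  det zero    M = 1#
  det (suc m) M =
    altSum (suc m) (λ j → M zero j * det m (λ i k → M (suc i) (punchIn j k)))

module _ {c ℓ} (F : Field c ℓ) where
  open Field F
  open Poly F

  cauchySqMatrix : ∀ d → (Fin d → Carrier) → Fin d → Fin d → Frac d
  cauchySqMatrix d μ i j =
    _/F_ {d} (1F {d}) (_*F_ {d} yμ yμ)
    where
      yμ : Frac d
      yμ = fromPoly {d} (subP d (var d i) (constP d (μ j)))

  detF : ∀ d → (Fin d → Fin d → Frac d) → Frac d
  detF d = Det.det (_+F_ {d}) (_*F_ {d}) (-F_ {d}) (0F {d}) (1F {d}) d

-- Evaluating numerator and denominator at a point x whose coordinates avoid all μⱼ turns
-- det A into the numeric determinant D_μ(x) = det (1 / (xᵢ - μⱼ)²), so if det A were zero,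
-- D_μ would vanish at every such point. This is refuted by induction on d. Expanding along
-- the first row and clearing denominators, t ↦ D_μ(t, q) · ∏ⱼ (t - μⱼ)² is a polynomial of
-- degree ≤ 2d whose value at t = μ₁ is ∏_{j>1} (μ₁ - μⱼ)² times the minor D_{μ₂…μ_d}(q).
-- In characteristic zero there are arbitrarily many admissible t, so this polynomial (times
-- a factor vanishing at the finitely many other forbidden values) is identically zero, and
-- hence the minor vanishes at every admissible q. Equality in F is not decidable, so
-- "vanishes at every admissible point" is only available under double negation, and the
-- induction carries along a growing list of forbidden values.

module Submission where

open import Defs
open import Level using (_⊔_; Lift; lift)
open import Data.Nat as ℕ using (ℕ; zero; suc)
import Data.Nat.Properties as ℕ
open import Data.Fin using (Fin; zero; suc; punchIn; toℕ)
import Data.Fin.Properties as Fin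
open import Data.Vec.Functional as Vector using (Vector)
open import Data.List using (List; []; _∷_; map)
open import Data.List.Relation.Unary.All using ([]; _∷_)
open import Data.Product using (_×_; _,_; proj₁; proj₂; Σ-syntax)
open import Function using (_∘_)
open import Relation.Nullary using (¬_; yes; no)
open import Relation.Nullary.Negation using (¬¬-map)
open import Relation.Nullary.Decidable using (¬¬-excluded-middle)
open import Relation.Binary.PropositionalEquality as ≡ using (_≢_)
open import Algebra.Bundles using (CommutativeRing)
import Algebra.Properties.Ring as RingProperties
import Algebra.Properties.CommutativeMonoid.Sum as MonoidSum
import Relation.Binary.Reasoning.Setoid as SetoidReasoning

¬¬-∀-Fin : ∀ {a n} (P : Fin n → Set a) → (∀ i → ¬ ¬ P i) → ¬ ¬ (∀ i → P i)
¬¬-∀-Fin {n = zero}  P ¬¬P k = k (λ ())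
¬¬-∀-Fin {n = suc n} P ¬¬P k =
  ¬¬P zero λ P₀ → ¬¬-∀-Fin (P ∘ suc) (¬¬P ∘ suc) λ P₊ → k λ { zero → P₀ ; (suc i) → P₊ i }

module CommutativeRingIdentities {c ℓ} (R : CommutativeRing c ℓ) where
  open CommutativeRing R
  open import Algebra.Solver.Ring.NaturalCoefficients.Default commutativeSemiring

  horner-+ : ∀ a b x p q → (a + b) + x * (p + q) ≈ (a + x * p) + (b + x * q)
  horner-+ = solve 5 (λ a b x p q → (a :+ b) :+ x :* (p :+ q) := (a :+ x :* p) :+ (b :+ x :* q)) refl

  horner-*ˡ : ∀ k a x p → k * (a + x * p) ≈ k * a + x * (k * p)
  horner-*ˡ = solve 4 (λ k a x p → k :* (a :+ x :* p) := k :* a :+ x :* (k :* p)) refl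

  horner-*ʳ : ∀ a x p q → a * q + x * (p * q) ≈ (a + x * p) * q
  horner-*ʳ = solve 4 (λ a x p q → a :* q :+ x :* (p :* q) := (a :+ x :* p) :* q) refl

  horner-* : ∀ a b x p q → (a + x * p) * (b + x * q) ≈ a * b + x * (p * (b + x * q) + a * q)
  horner-* = solve 5 (λ a b x p q → (a :+ x :* p) :* (b :+ x :* q) := a :* b :+ x :* (p :* (b :+ x :* q) :+ a :* q)) refl

  -- With a' = - a and b' = - b this is t - b ≈ (a - b) + (t - a) · 1.
  translate-difference : ∀ t b a a' → (t + b) + (a + a') ≈ (a + b) + (t + a') * 1#
  translate-difference = solve 4 (λ t b a a' → (t :+ b) :+ (a :+ a') := (a :+ b) :+ (t :+ a') :* con 1) refl

  fraction-+ : ∀ u v b d → (u * b) * d + (v * d) * b ≈ (u + v) * (b * d)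
  fraction-+ = solve 4 (λ u v b d → (u :* b) :* d :+ (v :* d) :* b := (u :+ v) :* (b :* d)) refl

  fraction-* : ∀ u v b d → (u * b) * (v * d) ≈ (u * v) * (b * d)
  fraction-* = solve 4 (λ u v b d → (u :* b) :* (v :* d) := (u :* v) :* (b :* d)) refl

  fraction-/ : ∀ u v w b d → (v * w) * ((u * b) * d) ≈ (u * w) * (b * (v * d))
  fraction-/ = solve 5 (λ u v w b d → (v :* w) :* ((u :* b) :* d) := (u :* w) :* (b :* (v :* d))) refl

  clear-denominator : ∀ w m s p → (w * m) * (s * p) ≈ (s * w) * (m * p)
  clear-denominator = solve 4 (λ w m s p → (w :* m) :* (s :* p) := (s :* w) :* (m :* p)) refl

module Products {c ℓ} (R : CommutativeRing c ℓ) where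
  open CommutativeRing R hiding (zero)
  open RingProperties ring using (-0#≈0#; -‿distribˡ-*)
  open SetoidReasoning setoid
  open MonoidSum *-commutativeMonoid public using () renaming (sum to ∏; sum-remove to ∏-remove)
  open Det _+_ _*_ -_ 0# 1# public using (altSum; det)

  ∏-≈0 : ∀ {m} (f : Vector Carrier m) k → f k ≈ 0# → ∏ f ≈ 0#
  ∏-≈0 {suc m} f k fk≈0 = begin
    ∏ f                              ≈⟨ ∏-remove {i = k} f ⟩
    f k * ∏ (Vector.removeAt f k)    ≈⟨ *-congʳ fk≈0 ⟩
    0# * ∏ (Vector.removeAt f k)     ≈⟨ zeroˡ _ ⟩
    0#                               ∎

  ∏-punchIn-suc-≈0 : ∀ {m} (f : Vector Carrier (suc m)) (j : Fin m) →
                     f zero ≈ 0# → ∏ (f ∘ punchIn (suc j)) ≈ 0#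
  ∏-punchIn-suc-≈0 {suc m} f j = ∏-≈0 (f ∘ punchIn (suc j)) zero

  altSum-cong : ∀ m {f g : Vector Carrier m} → (∀ j → f j ≈ g j) → altSum m f ≈ altSum m g
  altSum-cong zero    f≈g = refl
  altSum-cong (suc m) f≈g = +-cong (f≈g zero) (-‿cong (altSum-cong m (f≈g ∘ suc)))

  altSum-≈0 : ∀ m {f : Vector Carrier m} → (∀ j → f j ≈ 0#) → altSum m f ≈ 0#
  altSum-≈0 zero    f≈0 = refl
  altSum-≈0 (suc m) f≈0 = begin
    _              ≈⟨ +-cong (f≈0 zero) (-‿cong (altSum-≈0 m (f≈0 ∘ suc))) ⟩
    0# + - 0#      ≈⟨ +-identityˡ _ ⟩
    - 0#           ≈⟨ -0#≈0# ⟩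
    0#             ∎

  altSum-*ʳ : ∀ m (f : Vector Carrier m) x → altSum m f * x ≈ altSum m (λ j → f j * x)
  altSum-*ʳ zero    f x = zeroˡ x
  altSum-*ʳ (suc m) f x = begin
    (f zero + - altSum m (f ∘ suc)) * x          ≈⟨ distribʳ x _ _ ⟩
    f zero * x + - altSum m (f ∘ suc) * x        ≈⟨ +-congˡ (sym (-‿distribˡ-* _ _)) ⟩
    f zero * x + - (altSum m (f ∘ suc) * x)      ≈⟨ +-congˡ (-‿cong (altSum-*ʳ m (f ∘ suc) x)) ⟩
    f zero * x + - altSum m (λ j → f (suc j) * x) ∎

module PolynomialFunctions {c ℓ} (R : CommutativeRing c ℓ) where
  open CommutativeRing R hiding (zero)
  open CommutativeRingIdentities R
  open Products R
  open RingProperties ring using (-1*x≈-x)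
  open SetoidReasoning setoid

  -- A constructive, coefficient-free notion of polynomial function: f has degree ≤ n + 1
  -- when at every point a it factors as f t = f a + (t - a) h t with h of degree ≤ n.
  DegreeAtMost : ℕ → (Carrier → Carrier) → Set (c ⊔ ℓ)
  DegreeAtMost zero    f = Lift c (∀ s t → f s ≈ f t)
  DegreeAtMost (suc n) f =
    ∀ a → Σ[ h ∈ (Carrier → Carrier) ] DegreeAtMost n h × (∀ t → f t ≈ f a + (t - a) * h t)

  DegreeAtMost-cong : ∀ n {f g} → (∀ t → f t ≈ g t) → DegreeAtMost n f → DegreeAtMost n g
  DegreeAtMost-cong zero    f≈g (lift f-const) = lift λ s t → trans (sym (f≈g s)) (trans (f-const s t) (f≈g t))
  DegreeAtMost-cong (suc n) f≈g f-deg a with f-deg a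
  ... | h , h-deg , f≈ = h , h-deg , λ t → trans (sym (f≈g t)) (trans (f≈ t) (+-congʳ (f≈g a)))

  DegreeAtMost-const : ∀ n k → DegreeAtMost n (λ _ → k)
  DegreeAtMost-const zero    k   = lift λ _ _ → refl
  DegreeAtMost-const (suc n) k a =
    (λ _ → 0#) , DegreeAtMost-const n 0# , λ t → sym (trans (+-congˡ (zeroʳ _)) (+-identityʳ k))

  DegreeAtMost-suc : ∀ n f → DegreeAtMost n f → DegreeAtMost (suc n) f
  DegreeAtMost-suc zero    f (lift f-const) a =
    (λ _ → 0#) , DegreeAtMost-const 0 0# , λ t → trans (f-const t a) (sym (trans (+-congˡ (zeroʳ _)) (+-identityʳ _)))
  DegreeAtMost-suc (suc n) f f-deg a with f-deg a
  ... | h , h-deg , f≈ = h , DegreeAtMost-suc n h h-deg , f≈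

  DegreeAtMost-weaken : ∀ k n f → DegreeAtMost n f → DegreeAtMost (k ℕ.+ n) f
  DegreeAtMost-weaken zero    n f f-deg = f-deg
  DegreeAtMost-weaken (suc k) n f f-deg = DegreeAtMost-suc (k ℕ.+ n) f (DegreeAtMost-weaken k n f f-deg)

  DegreeAtMost-+ : ∀ n f g → DegreeAtMost n f → DegreeAtMost n g → DegreeAtMost n (λ t → f t + g t)
  DegreeAtMost-+ zero    f g (lift f-const) (lift g-const) = lift λ s t → +-cong (f-const s t) (g-const s t)
  DegreeAtMost-+ (suc n) f g f-deg g-deg a with f-deg a | g-deg a
  ... | hf , hf-deg , f≈ | hg , hg-deg , g≈ =
    (λ t → hf t + hg t) , DegreeAtMost-+ n hf hg hf-deg hg-deg ,
    λ t → trans (+-cong (f≈ t) (g≈ t)) (sym (horner-+ _ _ _ _ _))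

  DegreeAtMost-*ˡ : ∀ n k f → DegreeAtMost n f → DegreeAtMost n (λ t → k * f t)
  DegreeAtMost-*ˡ zero    k f (lift f-const) = lift λ s t → *-congˡ (f-const s t)
  DegreeAtMost-*ˡ (suc n) k f f-deg a with f-deg a
  ... | h , h-deg , f≈ =
    (λ t → k * h t) , DegreeAtMost-*ˡ n k h h-deg , λ t → trans (*-congˡ (f≈ t)) (horner-*ˡ _ _ _ _)

  DegreeAtMost-- : ∀ n f → DegreeAtMost n f → DegreeAtMost n (λ t → - f t)
  DegreeAtMost-- n f f-deg = DegreeAtMost-cong n (λ t → -1*x≈-x (f t)) (DegreeAtMost-*ˡ n (- 1#) f f-deg)

  DegreeAtMost-* : ∀ m n f g → DegreeAtMost m f → DegreeAtMost n g → DegreeAtMost (m ℕ.+ n) (λ t → f t * g t)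
  DegreeAtMost-* zero    n f g (lift f-const) g-deg =
    DegreeAtMost-cong n (λ t → *-congʳ (f-const 0# t)) (DegreeAtMost-*ˡ n (f 0#) g g-deg)
  DegreeAtMost-* (suc m) n f g f-deg g-deg a with f-deg a | DegreeAtMost-suc n g g-deg a
  ... | hf , hf-deg , f≈ | hg , hg-deg , g≈ =
    (λ t → hf t * g t + f a * hg t) ,
    DegreeAtMost-+ (m ℕ.+ n) _ _ (DegreeAtMost-* m n hf g hf-deg g-deg)
                                 (DegreeAtMost-weaken m n _ (DegreeAtMost-*ˡ n (f a) hg hg-deg)) ,
    λ t → begin
      f t * g t                                                    ≈⟨ *-cong (f≈ t) (g≈ t) ⟩
      (f a + (t - a) * hf t) * (g a + (t - a) * hg t)              ≈⟨ horner-* _ _ _ _ _ ⟩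
      f a * g a + (t - a) * (hf t * (g a + (t - a) * hg t) + f a * hg t)
        ≈⟨ +-congˡ (*-congˡ (+-congʳ (*-congˡ (sym (g≈ t))))) ⟩
      f a * g a + (t - a) * (hf t * g t + f a * hg t)              ∎

  DegreeAtMost-linear : ∀ b → DegreeAtMost 1 (λ t → t - b)
  DegreeAtMost-linear b a = (λ _ → 1#) , DegreeAtMost-const 0 1# , λ t → begin
    t - b                          ≈⟨ sym (+-identityʳ _) ⟩
    (t - b) + 0#                   ≈⟨ +-congˡ (sym (-‿inverseʳ a)) ⟩
    (t - b) + (a - a)              ≈⟨ translate-difference t (- b) a (- a) ⟩
    (a - b) + (t - a) * 1#         ∎

  DegreeAtMost-square : ∀ b → DegreeAtMost 2 (λ t → (t - b) * (t - b))
  DegreeAtMost-square b = DegreeAtMost-* 1 1 _ _ (DegreeAtMost-linear b) (DegreeAtMost-linear b)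

  DegreeAtMost-∏ : ∀ m n (f : Fin m → Carrier → Carrier) → (∀ k → DegreeAtMost n (f k)) →
                   DegreeAtMost (m ℕ.* n) (λ t → ∏ (λ k → f k t))
  DegreeAtMost-∏ zero    n f f-deg = DegreeAtMost-const 0 1#
  DegreeAtMost-∏ (suc m) n f f-deg =
    DegreeAtMost-* n (m ℕ.* n) _ _ (f-deg zero) (DegreeAtMost-∏ m n (f ∘ suc) (f-deg ∘ suc))

  DegreeAtMost-altSum : ∀ m n (f : Fin m → Carrier → Carrier) → (∀ j → DegreeAtMost n (f j)) →
                        DegreeAtMost n (λ t → altSum m (λ j → f j t))
  DegreeAtMost-altSum zero    n f f-deg = DegreeAtMost-const n 0#
  DegreeAtMost-altSum (suc m) n f f-deg =
    DegreeAtMost-+ n _ _ (f-deg zero) (DegreeAtMost-- n _ (DegreeAtMost-altSum m n (f ∘ suc) (f-deg ∘ suc)))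

module FieldProperties {c ℓ} (F : Field c ℓ) where
  open Field F hiding (zero)
  open Products commutativeRing
  open PolynomialFunctions commutativeRing
  open RingProperties ring using (+-cancelˡ; x≈y⇒x∙y⁻¹≈ε; x∙y⁻¹≈ε⇒x≈y)
  open SetoidReasoning setoid

  Distinct : ∀ {n} → Vector Carrier n → Set ℓ
  Distinct v = ∀ i j → i ≢ j → v i ≉ v j

  x≉0⇒x*y≈0⇒y≈0 : ∀ {x y} → x ≉ 0# → x * y ≈ 0# → y ≈ 0#
  x≉0⇒x*y≈0⇒y≈0 {x} {y} x≉0 xy≈0 with inverse x x≉0
  ... | x⁻¹ , xx⁻¹≈1 = begin
    y                 ≈⟨ sym (*-identityˡ y) ⟩
    1# * y            ≈⟨ *-congʳ (trans (sym xx⁻¹≈1) (*-comm x x⁻¹)) ⟩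
    (x⁻¹ * x) * y     ≈⟨ *-assoc x⁻¹ x y ⟩
    x⁻¹ * (x * y)     ≈⟨ *-congˡ xy≈0 ⟩
    x⁻¹ * 0#          ≈⟨ zeroʳ x⁻¹ ⟩
    0#                ∎

  *-≉0 : ∀ {x y} → x ≉ 0# → y ≉ 0# → x * y ≉ 0#
  *-≉0 x≉0 y≉0 = y≉0 ∘ x≉0⇒x*y≈0⇒y≈0 x≉0

  x*y≉0⇒x≉0 : ∀ {x y} → x * y ≉ 0# → x ≉ 0#
  x*y≉0⇒x≉0 xy≉0 x≈0 = xy≉0 (trans (*-congʳ x≈0) (zeroˡ _))

  x*y≉0⇒y≉0 : ∀ {x y} → x * y ≉ 0# → y ≉ 0#
  x*y≉0⇒y≉0 xy≉0 y≈0 = xy≉0 (trans (*-congˡ y≈0) (zeroʳ _))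

  x≉y⇒x-y≉0 : ∀ {x y} → x ≉ y → x - y ≉ 0#
  x≉y⇒x-y≉0 x≉y = x≉y ∘ x∙y⁻¹≈ε⇒x≈y _ _

  x-y≉0⇒x≉y : ∀ {x y} → x - y ≉ 0# → x ≉ y
  x-y≉0⇒x≉y x-y≉0 = x-y≉0 ∘ x≈y⇒x∙y⁻¹≈ε

  ∏-≉0 : ∀ {m} (f : Vector Carrier m) → (∀ k → f k ≉ 0#) → ∏ f ≉ 0#
  ∏-≉0 {zero}  f f≉0 = 1≉0
  ∏-≉0 {suc m} f f≉0 = *-≉0 (f≉0 zero) (∏-≉0 (f ∘ suc) (f≉0 ∘ suc))

  ∏-≉0⇒≉0 : ∀ {m} (f : Vector Carrier m) → ∏ f ≉ 0# → ∀ k → f k ≉ 0#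
  ∏-≉0⇒≉0 f ∏f≉0 k fk≈0 = ∏f≉0 (∏-≈0 f k fk≈0)

  vanishes-on-distinct⇒≈0 : ∀ n f → DegreeAtMost n f → (a : Fin (suc n) → Carrier) → Distinct a →
                             (∀ i → f (a i) ≈ 0#) → ∀ t → f t ≈ 0#
  vanishes-on-distinct⇒≈0 zero    f (lift f-const) a _ fa≈0 t = trans (f-const t (a zero)) (fa≈0 zero)
  vanishes-on-distinct⇒≈0 (suc n) f f-deg a a-distinct fa≈0 t with f-deg (a zero)
  ... | h , h-deg , f≈ = begin
    f t                              ≈⟨ f≈ t ⟩
    f (a zero) + (t - a zero) * h t  ≈⟨ +-cong (fa≈0 zero) (*-congˡ (h≈0 t)) ⟩
    0# + (t - a zero) * 0#           ≈⟨ +-identityˡ _ ⟩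
    (t - a zero) * 0#                ≈⟨ zeroʳ _ ⟩
    0#                               ∎
    where
      h-at-root : ∀ i → h (a (suc i)) ≈ 0#
      h-at-root i = x≉0⇒x*y≈0⇒y≈0 (x≉y⇒x-y≉0 (a-distinct (suc i) zero λ ())) (begin
        (a (suc i) - a zero) * h (a (suc i))               ≈⟨ sym (+-identityˡ _) ⟩
        0# + (a (suc i) - a zero) * h (a (suc i))          ≈⟨ +-congʳ (sym (fa≈0 zero)) ⟩
        f (a zero) + (a (suc i) - a zero) * h (a (suc i))  ≈⟨ sym (f≈ (a (suc i))) ⟩
        f (a (suc i))                                      ≈⟨ fa≈0 (suc i) ⟩
        0#                                                 ∎)

      h≈0 : ∀ t → h t ≈ 0#
      h≈0 = vanishes-on-distinct⇒≈0 n h h-deg (a ∘ suc)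
              (λ i j i≢j → a-distinct (suc i) (suc j) (i≢j ∘ Fin.suc-injective)) h-at-root

  natF-injective : CharZero F → ∀ m n → m ≢ n → natF F m ≉ natF F n
  natF-injective char0 zero    zero    m≢n _ = m≢n ≡.refl
  natF-injective char0 zero    (suc n) _   0≈n = char0 n (sym 0≈n)
  natF-injective char0 (suc m) zero    _   m≈0 = char0 m m≈0
  natF-injective char0 (suc m) (suc n) m≢n m≈n =
    natF-injective char0 m n (m≢n ∘ ≡.cong suc) (+-cancelˡ 1# _ _ m≈n)

  shiftedNaturals : Carrier → ∀ {N} → Vector Carrier N
  shiftedNaturals a i = a + natF F (suc (toℕ i))

  shiftedNaturals-distinct : CharZero F → ∀ a {N} → Distinct (shiftedNaturals a {N})
  shiftedNaturals-distinct char0 a i j i≢j a+i≈a+j =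
    natF-injective char0 _ _ (i≢j ∘ Fin.toℕ-injective ∘ ℕ.suc-injective) (+-cancelˡ a _ _ a+i≈a+j)

  shiftedNaturals-≉ : CharZero F → ∀ a {N} (i : Fin N) → shiftedNaturals a i ≉ a
  shiftedNaturals-≉ char0 a i a+i≈a = char0 (toℕ i) (+-cancelˡ a _ _ (trans a+i≈a (sym (+-identityʳ a))))

module Evaluation {c ℓ} (F : Field c ℓ) where
  open Field F hiding (zero)
  open Poly F
  open CommutativeRingIdentities commutativeRing
  open Products commutativeRing
  open FieldProperties F
  open RingProperties ring using (-0#≈0#; -‿distribˡ-*; -‿distribʳ-*; -‿+-comm; x∙y⁻¹≈ε⇒x≈y)
  open SetoidReasoning setoid

  eval : ∀ n → Vector Carrier n → Poly n → Carrier
  evalList : ∀ n → Vector Carrier (suc n) → List (Poly n) → Carrier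
  eval zero    x a = a
  eval (suc n) x p = evalList n x p
  evalList n x []      = 0#
  evalList n x (a ∷ p) = eval n (x ∘ suc) a + x zero * evalList n x p

  eval-zeroP : ∀ n x → eval n x (zeroP n) ≈ 0#
  eval-zeroP zero    x = refl
  eval-zeroP (suc n) x = refl

  eval-constP : ∀ n x a → eval n x (constP n a) ≈ a
  eval-constP zero    x a = refl
  eval-constP (suc n) x a = begin
    eval n (x ∘ suc) (constP n a) + x zero * 0#  ≈⟨ +-cong (eval-constP n _ a) (zeroʳ _) ⟩
    a + 0#                                       ≈⟨ +-identityʳ a ⟩
    a                                            ∎

  eval-negP : ∀ n x p → eval n x (negP n p) ≈ - eval n x p
  evalList-negP : ∀ n x p → evalList n x (map (negP n) p) ≈ - evalList n x p
  eval-negP zero    x a = refl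
  eval-negP (suc n) x p = evalList-negP n x p
  evalList-negP n x []      = sym -0#≈0#
  evalList-negP n x (a ∷ p) = begin
    eval n _ (negP n a) + x zero * evalList n x (map (negP n) p)
      ≈⟨ +-cong (eval-negP n _ a) (*-congˡ (evalList-negP n x p)) ⟩
    - eval n _ a + x zero * - evalList n x p    ≈⟨ +-congˡ (sym (-‿distribʳ-* _ _)) ⟩
    - eval n _ a + - (x zero * evalList n x p)  ≈⟨ -‿+-comm _ _ ⟩
    - (eval n _ a + x zero * evalList n x p)    ∎

  eval-addP : ∀ n x p q → eval n x (addP n p q) ≈ eval n x p + eval n x q
  evalList-addP : ∀ n x p q → evalList n x (addL (addP n) p q) ≈ evalList n x p + evalList n x q
  eval-addP zero    x a b = refl
  eval-addP (suc n) x p q = evalList-addP n x p q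
  evalList-addP n x []      q       = sym (+-identityˡ _)
  evalList-addP n x (a ∷ p) []      = sym (+-identityʳ _)
  evalList-addP n x (a ∷ p) (b ∷ q) = begin
    eval n _ (addP n a b) + x zero * evalList n x (addL (addP n) p q)
      ≈⟨ +-cong (eval-addP n _ a b) (*-congˡ (evalList-addP n x p q)) ⟩
    (eval n _ a + eval n _ b) + x zero * (evalList n x p + evalList n x q)
      ≈⟨ horner-+ _ _ _ _ _ ⟩
    (eval n _ a + x zero * evalList n x p) + (eval n _ b + x zero * evalList n x q) ∎

  eval-subP : ∀ n x p q → eval n x (subP n p q) ≈ eval n x p - eval n x q
  eval-subP n x p q = trans (eval-addP n x p _) (+-congˡ (eval-negP n x q))

  eval-mulP : ∀ n x p q → eval n x (mulP n p q) ≈ eval n x p * eval n x q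
  evalList-mulL : ∀ n x p q → evalList n x (mulL n p q) ≈ evalList n x p * evalList n x q
  evalList-map-mulP : ∀ n x a q →
                      evalList n x (map (mulP n a) q) ≈ eval n (x ∘ suc) a * evalList n x q
  eval-mulP zero    x a b = refl
  eval-mulP (suc n) x p q = evalList-mulL n x p q
  evalList-mulL n x []      q = sym (zeroˡ _)
  evalList-mulL n x (a ∷ p) q = begin
    evalList n x (addL (addP n) (map (mulP n a) q) (zeroP n ∷ mulL n p q))
      ≈⟨ evalList-addP n x (map (mulP n a) q) (zeroP n ∷ mulL n p q) ⟩
    evalList n x (map (mulP n a) q) + (eval n _ (zeroP n) + x zero * evalList n x (mulL n p q))
      ≈⟨ +-cong (evalList-map-mulP n x a q) (+-cong (eval-zeroP n _) (*-congˡ (evalList-mulL n x p q))) ⟩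
    eval n _ a * evalList n x q + (0# + x zero * (evalList n x p * evalList n x q))
      ≈⟨ +-congˡ (+-identityˡ _) ⟩
    eval n _ a * evalList n x q + x zero * (evalList n x p * evalList n x q)
      ≈⟨ horner-*ʳ _ _ _ _ ⟩
    (eval n _ a + x zero * evalList n x p) * evalList n x q ∎
  evalList-map-mulP n x a []      = sym (zeroʳ _)
  evalList-map-mulP n x a (b ∷ q) = begin
    eval n _ (mulP n a b) + x zero * evalList n x (map (mulP n a) q)
      ≈⟨ +-cong (eval-mulP n _ a b) (*-congˡ (evalList-map-mulP n x a q)) ⟩
    eval n _ a * eval n _ b + x zero * (eval n _ a * evalList n x q)
      ≈⟨ sym (horner-*ˡ _ _ _ _) ⟩
    eval n _ a * (eval n _ b + x zero * evalList n x q) ∎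

  eval-var : ∀ n x i → eval n x (var n i) ≈ x i
  eval-var (suc n) x zero = begin
    eval n _ (zeroP n) + x zero * (eval n _ (oneP n) + x zero * 0#)
      ≈⟨ +-cong (eval-zeroP n _) (*-congˡ (+-cong (eval-constP n _ 1#) (zeroʳ _))) ⟩
    0# + x zero * (1# + 0#)  ≈⟨ +-identityˡ _ ⟩
    x zero * (1# + 0#)       ≈⟨ *-congˡ (+-identityʳ 1#) ⟩
    x zero * 1#              ≈⟨ *-identityʳ _ ⟩
    x zero                   ∎
  eval-var (suc n) x (suc i) = begin
    eval n _ (var n i) + x zero * 0#  ≈⟨ +-cong (eval-var n _ i) (zeroʳ _) ⟩
    x (suc i) + 0#                    ≈⟨ +-identityʳ _ ⟩
    x (suc i)                         ∎

  eval-IsZero : ∀ n x p → IsZero n p → eval n x p ≈ 0#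
  evalList-IsZero : ∀ n x p → IsZero (suc n) p → evalList n x p ≈ 0#
  eval-IsZero zero    x a (lift a≈0) = a≈0
  eval-IsZero (suc n) x p p≈0        = evalList-IsZero n x p p≈0
  evalList-IsZero n x []      []              = refl
  evalList-IsZero n x (a ∷ p) (a≈0 ∷ p≈0) = begin
    eval n _ a + x zero * evalList n x p  ≈⟨ +-cong (eval-IsZero n _ a a≈0) (*-congˡ (evalList-IsZero n x p p≈0)) ⟩
    0# + x zero * 0#                      ≈⟨ +-identityˡ _ ⟩
    x zero * 0#                           ≈⟨ zeroʳ _ ⟩
    0#                                    ∎

  eval-≈P : ∀ n x {p q} → _≈P_ {n} p q → eval n x p ≈ eval n x q
  eval-≈P n x {p} {q} p≈q = x∙y⁻¹≈ε⇒x≈y _ _ (trans (sym (eval-subP n x p q)) (eval-IsZero n x _ p≈q))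

  module DetF (n : ℕ) = Det (_+F_ {n}) (_*F_ {n}) (-F_ {n}) (0F {n}) (1F {n})

  module _ (n : ℕ) (x : Vector Carrier n) where

    Represents : Frac n → Carrier → Set ℓ
    Represents (a , b) v = eval n x b ≉ 0# × eval n x a ≈ v * eval n x b

    Represents-resp : ∀ X {u v} → u ≈ v → Represents X u → Represents X v
    Represents-resp X u≈v (b≉0 , a≈ub) = b≉0 , trans a≈ub (*-congʳ u≈v)

    oneP≉0 : eval n x (oneP n) ≉ 0#
    oneP≉0 1≈0 = 1≉0 (trans (sym (eval-constP n x 1#)) 1≈0)

    Represents-fromPoly : ∀ p → Represents (fromPoly {n} p) (eval n x p)
    Represents-fromPoly p = oneP≉0 , sym (trans (*-congˡ (eval-constP n x 1#)) (*-identityʳ _))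

    Represents-0F : Represents (0F {n}) 0#
    Represents-0F = oneP≉0 , trans (eval-zeroP n x) (sym (zeroˡ _))

    Represents-1F : Represents (1F {n}) 1#
    Represents-1F = oneP≉0 , sym (*-identityˡ _)

    denominator-≉0 : ∀ b d → eval n x b ≉ 0# → eval n x d ≉ 0# → eval n x (mulP n b d) ≉ 0#
    denominator-≉0 b d b≉0 d≉0 bd≈0 = *-≉0 b≉0 d≉0 (trans (sym (eval-mulP n x b d)) bd≈0)

    Represents-+ : ∀ X Y {u v} → Represents X u → Represents Y v → Represents (_+F_ {n} X Y) (u + v)
    Represents-+ (a , b) (c′ , d) {u} {v} (b≉0 , a≈ub) (d≉0 , c≈vd) = denominator-≉0 b d b≉0 d≉0 , (begin
      eval n x (addP n (mulP n a d) (mulP n c′ b))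
        ≈⟨ trans (eval-addP n x _ _) (+-cong (eval-mulP n x a d) (eval-mulP n x c′ b)) ⟩
      eval n x a * eval n x d + eval n x c′ * eval n x b
        ≈⟨ +-cong (*-congʳ a≈ub) (*-congʳ c≈vd) ⟩
      (u * eval n x b) * eval n x d + (v * eval n x d) * eval n x b
        ≈⟨ fraction-+ _ _ _ _ ⟩
      (u + v) * (eval n x b * eval n x d)
        ≈⟨ *-congˡ (sym (eval-mulP n x b d)) ⟩
      (u + v) * eval n x (mulP n b d) ∎)

    Represents-* : ∀ X Y {u v} → Represents X u → Represents Y v → Represents (_*F_ {n} X Y) (u * v)
    Represents-* (a , b) (c′ , d) {u} {v} (b≉0 , a≈ub) (d≉0 , c≈vd) = denominator-≉0 b d b≉0 d≉0 , (begin
      eval n x (mulP n a c′)                         ≈⟨ eval-mulP n x a c′ ⟩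
      eval n x a * eval n x c′                       ≈⟨ *-cong a≈ub c≈vd ⟩
      (u * eval n x b) * (v * eval n x d)            ≈⟨ fraction-* _ _ _ _ ⟩
      (u * v) * (eval n x b * eval n x d)            ≈⟨ *-congˡ (sym (eval-mulP n x b d)) ⟩
      (u * v) * eval n x (mulP n b d)                ∎)

    Represents-- : ∀ X {u} → Represents X u → Represents (-F_ {n} X) (- u)
    Represents-- (a , b) {u} (b≉0 , a≈ub) = b≉0 , (begin
      eval n x (negP n a)     ≈⟨ eval-negP n x a ⟩
      - eval n x a            ≈⟨ -‿cong a≈ub ⟩
      - (u * eval n x b)      ≈⟨ -‿distribˡ-* _ _ ⟩
      - u * eval n x b        ∎)

    Represents-/ : ∀ X Y {u v w} → Represents X u → Represents Y v → v ≉ 0# → v * w ≈ 1# →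
                   Represents (_/F_ {n} X Y) (u * w)
    Represents-/ (a , b) (c′ , d) {u} {v} {w} (b≉0 , a≈ub) (d≉0 , c≈vd) v≉0 vw≈1 =
      denominator-≉0 b c′ b≉0 c≉0 , (begin
        eval n x (mulP n a d)                     ≈⟨ eval-mulP n x a d ⟩
        eval n x a * eval n x d                   ≈⟨ *-congʳ a≈ub ⟩
        (u * eval n x b) * eval n x d             ≈⟨ sym (*-identityˡ _) ⟩
        1# * ((u * eval n x b) * eval n x d)      ≈⟨ *-congʳ (sym vw≈1) ⟩
        (v * w) * ((u * eval n x b) * eval n x d) ≈⟨ fraction-/ _ _ _ _ _ ⟩
        (u * w) * (eval n x b * (v * eval n x d)) ≈⟨ *-congˡ (*-congˡ (sym c≈vd)) ⟩
        (u * w) * (eval n x b * eval n x c′)      ≈⟨ *-congˡ (sym (eval-mulP n x b c′)) ⟩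
        (u * w) * eval n x (mulP n b c′)          ∎)
      where
        c≉0 : eval n x c′ ≉ 0#
        c≉0 c≈0 = *-≉0 v≉0 d≉0 (trans (sym c≈vd) c≈0)

    Represents-altSum : ∀ m (X : Vector (Frac n) m) (v : Vector Carrier m) → (∀ j → Represents (X j) (v j)) →
                        Represents (DetF.altSum n m X) (altSum m v)
    Represents-altSum zero    X v X≈v = Represents-0F
    Represents-altSum (suc m) X v X≈v =
      Represents-+ (X zero) _ (X≈v zero) (Represents-- _ (Represents-altSum m (X ∘ suc) (v ∘ suc) (X≈v ∘ suc)))

    Represents-det : ∀ m (M : Fin m → Fin m → Frac n) (V : Fin m → Fin m → Carrier) →
                     (∀ i j → Represents (M i j) (V i j)) → Represents (DetF.det n m M) (det m V)
    Represents-det zero    M V M≈V = Represents-1F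
    Represents-det (suc m) M V M≈V = Represents-altSum (suc m) _ _ λ j →
      Represents-* (M zero j) _ (M≈V zero j)
        (Represents-det m (λ i k → M (suc i) (punchIn j k)) (λ i k → V (suc i) (punchIn j k))
                          (λ i k → M≈V (suc i) (punchIn j k)))

    Represents-≈F-0F : ∀ X {v} → _≈F_ {n} X (0F {n}) → Represents X v → v ≈ 0#
    Represents-≈F-0F (a , b) {v} X≈0 (b≉0 , a≈vb) = x≉0⇒x*y≈0⇒y≈0 b≉0 (begin
      eval n x b * v                            ≈⟨ *-comm _ v ⟩
      v * eval n x b                            ≈⟨ sym a≈vb ⟩
      eval n x a                                ≈⟨ sym (*-identityʳ _) ⟩
      eval n x a * 1#                           ≈⟨ sym (trans (eval-mulP n x a _) (*-congˡ (eval-constP n x 1#))) ⟩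
      eval n x (mulP n a (oneP n))              ≈⟨ eval-≈P n x X≈0 ⟩
      eval n x (mulP n (zeroP n) b)             ≈⟨ eval-mulP n x _ b ⟩
      eval n x (zeroP n) * eval n x b           ≈⟨ *-congʳ (eval-zeroP n x) ⟩
      0# * eval n x b                           ≈⟨ zeroˡ _ ⟩
      0#                                        ∎)

module CauchySquare {c ℓ} (F : Field c ℓ) where
  open Field F hiding (zero)
  open Poly F
  open CommutativeRingIdentities commutativeRing
  open Products commutativeRing
  open PolynomialFunctions commutativeRing
  open FieldProperties F
  open Evaluation F
  open RingProperties ring using (-0#≈0#)
  open SetoidReasoning setoid

  squaredDifference≉0 : ∀ {s m} → s ≉ m → (s - m) * (s - m) ≉ 0#
  squaredDifference≉0 s≉m = *-≉0 (x≉y⇒x-y≉0 s≉m) (x≉y⇒x-y≉0 s≉m)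

  invSquaredDifference : ∀ s m → s ≉ m → Carrier
  invSquaredDifference s m s≉m = proj₁ (inverse _ (squaredDifference≉0 s≉m))

  invSquaredDifference-inverse : ∀ s m (s≉m : s ≉ m) →
                                 (s - m) * (s - m) * invSquaredDifference s m s≉m ≈ 1#
  invSquaredDifference-inverse s m s≉m = proj₂ (inverse _ (squaredDifference≉0 s≉m))

  Avoids : ∀ {m n} → Vector Carrier m → Vector Carrier n → Set ℓ
  Avoids x μ = ∀ i j → x i ≉ μ j

  ∷-Avoids : ∀ {m n t} {x : Vector Carrier m} {μ : Vector Carrier n} →
             (∀ j → t ≉ μ j) → Avoids x μ → Avoids (t Vector.∷ x) μ
  ∷-Avoids t∉μ x∉μ zero    = t∉μ
  ∷-Avoids t∉μ x∉μ (suc i) = x∉μ i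

  cauchySqValue : ∀ {d} (μ x : Vector Carrier d) → Avoids x μ → Carrier
  cauchySqValue {d} μ x x∉μ = det d (λ i j → invSquaredDifference (x i) (μ j) (x∉μ i j))

  cauchySqMatrix-Represents : ∀ {d} (μ x : Vector Carrier d) (x∉μ : Avoids x μ) i j →
    Represents d x (cauchySqMatrix F d μ i j) (invSquaredDifference (x i) (μ j) (x∉μ i j))
  cauchySqMatrix-Represents {d} μ x x∉μ i j =
    Represents-resp d x _ (*-identityˡ _)
      (Represents-/ d x (1F {d}) _ (Represents-1F d x) (Represents-* d x y-μ y-μ y-μ≈ y-μ≈)
                    (squaredDifference≉0 (x∉μ i j)) (invSquaredDifference-inverse _ _ (x∉μ i j)))
    where
      y-μ : Frac d
      y-μ = fromPoly {d} (subP d (var d i) (constP d (μ j)))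

      y-μ≈ : Represents d x y-μ (x i - μ j)
      y-μ≈ = Represents-resp d x y-μ
               (trans (eval-subP d x _ _) (+-cong (eval-var d x i) (-‿cong (eval-constP d x (μ j)))))
               (Represents-fromPoly d x _)

  cauchySqDet-Represents : ∀ {d} (μ x : Vector Carrier d) (x∉μ : Avoids x μ) →
    Represents d x (detF F d (cauchySqMatrix F d μ)) (cauchySqValue μ x x∉μ)
  cauchySqDet-Represents {d} μ x x∉μ = Represents-det d x d _ _ (cauchySqMatrix-Represents μ x x∉μ)

  VanishesGenerically : ∀ {d e} → Vector Carrier d → Vector Carrier e → Set (c ⊔ ℓ)
  VanishesGenerically μ L = ∀ x (x∉μ : Avoids x μ) → Avoids x L → ¬ ¬ (cauchySqValue μ x x∉μ ≈ 0#)

  module FirstRowExpansion {d} (μ : Vector Carrier (suc d)) (q : Vector Carrier d) (q∉μ : Avoids q μ) where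

    minor : Fin (suc d) → Carrier
    minor j = det d (λ i k → invSquaredDifference (q i) (μ (punchIn j k)) (q∉μ i (punchIn j k)))

    commonDenominator : Carrier → Carrier
    commonDenominator t = ∏ (λ k → (t - μ k) * (t - μ k))

    clearedEntry : Fin (suc d) → Carrier → Carrier
    clearedEntry j t = ∏ (λ k → (t - μ (punchIn j k)) * (t - μ (punchIn j k)))

    clearedExpansion : Carrier → Carrier
    clearedExpansion t = altSum (suc d) (λ j → minor j * clearedEntry j t)

    clearedExpansion-degree : DegreeAtMost (d ℕ.* 2) clearedExpansion
    clearedExpansion-degree = DegreeAtMost-altSum (suc d) (d ℕ.* 2) _ λ j →
      DegreeAtMost-*ˡ (d ℕ.* 2) (minor j) _ (DegreeAtMost-∏ d 2 _ λ k → DegreeAtMost-square (μ (punchIn j k)))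

    clearedEntry-suc-μ₀≈0 : ∀ j → clearedEntry (suc j) (μ zero) ≈ 0#
    clearedEntry-suc-μ₀≈0 j = ∏-punchIn-suc-≈0 (λ k → (μ zero - μ k) * (μ zero - μ k)) j
                                (trans (*-congʳ (-‿inverseʳ _)) (zeroˡ _))

    clearedExpansion-μ₀ : clearedExpansion (μ zero) ≈ minor zero * clearedEntry zero (μ zero)
    clearedExpansion-μ₀ = begin
      minor zero * clearedEntry zero (μ zero) + - altSum d (λ j → minor (suc j) * clearedEntry (suc j) (μ zero))
        ≈⟨ +-congˡ (-‿cong (altSum-≈0 d λ j → trans (*-congˡ (clearedEntry-suc-μ₀≈0 j)) (zeroʳ _))) ⟩
      minor zero * clearedEntry zero (μ zero) + - 0#  ≈⟨ +-congˡ -0#≈0# ⟩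
      minor zero * clearedEntry zero (μ zero) + 0#    ≈⟨ +-identityʳ _ ⟩
      minor zero * clearedEntry zero (μ zero)         ∎

    clearedExpansion-correct : ∀ t (t∉μ : ∀ j → t ≉ μ j) →
      cauchySqValue μ (t Vector.∷ q) (∷-Avoids t∉μ q∉μ) * commonDenominator t ≈ clearedExpansion t
    clearedExpansion-correct t t∉μ = begin
      altSum (suc d) (λ j → w j * minor j) * commonDenominator t    ≈⟨ altSum-*ʳ (suc d) (λ j → w j * minor j) _ ⟩
      altSum (suc d) (λ j → (w j * minor j) * commonDenominator t)  ≈⟨ altSum-cong (suc d) clearTerm ⟩
      clearedExpansion t                                            ∎
      where
        w : Fin (suc d) → Carrier
        w j = invSquaredDifference t (μ j) (t∉μ j)

        clearTerm : ∀ j → (w j * minor j) * commonDenominator t ≈ minor j * clearedEntry j t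
        clearTerm j = begin
          (w j * minor j) * commonDenominator t
            ≈⟨ *-congˡ (∏-remove {i = j} (λ k → (t - μ k) * (t - μ k))) ⟩
          (w j * minor j) * ((t - μ j) * (t - μ j) * clearedEntry j t)
            ≈⟨ clear-denominator _ _ _ _ ⟩
          ((t - μ j) * (t - μ j) * w j) * (minor j * clearedEntry j t)
            ≈⟨ *-congʳ (invSquaredDifference-inverse _ _ (t∉μ j)) ⟩
          1# * (minor j * clearedEntry j t)
            ≈⟨ *-identityˡ _ ⟩
          minor j * clearedEntry j t ∎

  module ClearedPolynomial {d e} (μ : Vector Carrier (suc d)) (L : Vector Carrier e)
                           (q : Vector Carrier d) (q∉μ : Avoids q μ) where
    open FirstRowExpansion μ q q∉μ public

    forbidden : Carrier → Carrier
    forbidden t = ∏ (λ k → t - L k) * ∏ (λ k → t - μ (suc k))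

    cleared : Carrier → Carrier
    cleared t = clearedExpansion t * forbidden t

    N : ℕ
    N = d ℕ.* 2 ℕ.+ (e ℕ.* 1 ℕ.+ d ℕ.* 1)

    cleared-degree : DegreeAtMost N cleared
    cleared-degree = DegreeAtMost-* (d ℕ.* 2) _ _ _ clearedExpansion-degree
      (DegreeAtMost-* (e ℕ.* 1) (d ℕ.* 1) _ _ (DegreeAtMost-∏ e 1 _ (DegreeAtMost-linear ∘ L))
                                              (DegreeAtMost-∏ d 1 _ (DegreeAtMost-linear ∘ μ ∘ suc)))

    cleared-μ₀≉0 : Distinct μ → Avoids L μ → minor zero ≉ 0# → cleared (μ zero) ≉ 0#
    cleared-μ₀≉0 μ-distinct L∉μ minor₀≉0 =
      *-≉0 (λ expansion≈0 → *-≉0 minor₀≉0 clearedEntry₀≉0 (trans (sym clearedExpansion-μ₀) expansion≈0))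
           (*-≉0 (∏-≉0 _ λ k → x≉y⇒x-y≉0 λ μ₀≈Lₖ → L∉μ k zero (sym μ₀≈Lₖ))
                 (∏-≉0 _ λ k → x≉y⇒x-y≉0 (μ-distinct zero (suc k) λ ())))
      where
        clearedEntry₀≉0 : clearedEntry zero (μ zero) ≉ 0#
        clearedEntry₀≉0 = ∏-≉0 _ λ k → squaredDifference≉0 (μ-distinct zero (suc k) λ ())

    cleared-vanishes-off-forbidden : VanishesGenerically μ L → Avoids q L →
                                     ∀ t → t ≉ μ zero → forbidden t ≉ 0# → ¬ ¬ (cleared t ≈ 0#)
    cleared-vanishes-off-forbidden vanishes q∉L t t≉μ₀ forbidden≉0 =
      ¬¬-map cleared≈0 (vanishes (t Vector.∷ q) (∷-Avoids t∉μ q∉μ) (∷-Avoids t∉L q∉L))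
      where
        t∉μ : ∀ j → t ≉ μ j
        t∉μ zero    = t≉μ₀
        t∉μ (suc j) = x-y≉0⇒x≉y (∏-≉0⇒≉0 _ (x*y≉0⇒y≉0 forbidden≉0) j)

        t∉L : ∀ k → t ≉ L k
        t∉L k = x-y≉0⇒x≉y (∏-≉0⇒≉0 _ (x*y≉0⇒x≉0 forbidden≉0) k)

        cleared≈0 : cauchySqValue μ (t Vector.∷ q) (∷-Avoids t∉μ q∉μ) ≈ 0# → cleared t ≈ 0#
        cleared≈0 D≈0 = begin
          clearedExpansion t * forbidden t
            ≈⟨ *-congʳ (sym (clearedExpansion-correct t t∉μ)) ⟩
          cauchySqValue μ (t Vector.∷ q) (∷-Avoids t∉μ q∉μ) * commonDenominator t * forbidden t
            ≈⟨ *-congʳ (*-congʳ D≈0) ⟩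
          0# * commonDenominator t * forbidden t  ≈⟨ *-congʳ (zeroˡ _) ⟩
          0# * forbidden t                        ≈⟨ zeroˡ _ ⟩
          0#                                      ∎

    cleared-vanishes : VanishesGenerically μ L → Avoids q L → ∀ t → t ≉ μ zero → ¬ ¬ (cleared t ≈ 0#)
    cleared-vanishes vanishes q∉L t t≉μ₀ cleared≉0 = ¬¬-excluded-middle λ
      { (yes forbidden≈0) → cleared≉0 (trans (*-congˡ forbidden≈0) (zeroʳ _))
      ; (no forbidden≉0)  → cleared-vanishes-off-forbidden vanishes q∉L t t≉μ₀ forbidden≉0 cleared≉0
      }

  module _ (char0 : CharZero F) where

    VanishesGenerically-peel : ∀ {d e} (μ : Vector Carrier (suc d)) (L : Vector Carrier e) →
      Distinct μ → Avoids L μ → VanishesGenerically μ L → VanishesGenerically (μ ∘ suc) (μ zero Vector.∷ L)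
    VanishesGenerically-peel μ L μ-distinct L∉μ vanishes q q∉μ₊ q∉μ₀∷L minor₀≉0 =
      ¬¬-∀-Fin _ (λ i → cleared-vanishes vanishes q∉L (fresh i) (shiftedNaturals-≉ char0 (μ zero) i))
        λ cleared-fresh≈0 → cleared-μ₀≉0 μ-distinct L∉μ minor₀≉0
          (vanishes-on-distinct⇒≈0 N cleared cleared-degree fresh (shiftedNaturals-distinct char0 (μ zero))
                                   cleared-fresh≈0 (μ zero))
      where
        q∉μ : Avoids q μ
        q∉μ i zero    = q∉μ₀∷L i zero
        q∉μ i (suc j) = q∉μ₊ i j

        q∉L : Avoids q L
        q∉L i k = q∉μ₀∷L i (suc k)

        open ClearedPolynomial μ L q q∉μ

        fresh : Vector Carrier (suc N)
        fresh = shiftedNaturals (μ zero)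

    ¬VanishesGenerically : ∀ {d e} (μ : Vector Carrier d) (L : Vector Carrier e) →
                           Distinct μ → Avoids L μ → ¬ VanishesGenerically μ L
    ¬VanishesGenerically {zero}  μ L _ _ vanishes = vanishes (λ ()) (λ ()) (λ ()) 1≉0
    ¬VanishesGenerically {suc d} μ L μ-distinct L∉μ vanishes =
      ¬VanishesGenerically (μ ∘ suc) (μ zero Vector.∷ L)
        (λ i j i≢j → μ-distinct (suc i) (suc j) (i≢j ∘ Fin.suc-injective)) μ₀∷L∉μ₊
        (VanishesGenerically-peel μ L μ-distinct L∉μ vanishes)
      where
        μ₀∷L∉μ₊ : Avoids (μ zero Vector.∷ L) (μ ∘ suc)
        μ₀∷L∉μ₊ zero    j = μ-distinct zero (suc j) λ ()
        μ₀∷L∉μ₊ (suc k) j = L∉μ k (suc j)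

lemmaC1 : ∀ {c ℓ} (F : Field c ℓ) → CharZero F →
          (d : ℕ) (μ : Fin d → Field.Carrier F) →
          (∀ i j → i ≢ j → ¬ (Field._≈_ F (μ i) (μ j))) →
          (∀ i → ¬ (Field._≈_ F (μ i) (Field.0# F))) →
          ¬ (Poly._≈F_ F {d} (detF F d (cauchySqMatrix F d μ)) (Poly.0F F {d}))
lemmaC1 F char0 d μ μ-distinct _ det≈0 =
  ¬VanishesGenerically char0 {e = 0} μ (λ ()) μ-distinct (λ ()) λ x x∉μ _ ¬D≈0 →
    ¬D≈0 (Represents-≈F-0F d x _ det≈0 (cauchySqDet-Represents μ x x∉μ))
  where
    open CauchySquare F
    open Evaluation F
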